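{- There does not exist a $13\times 13$ complex matrix $H$ all of whose entries are complex $10$th roots of unity and with $HH^\ast=13I_{13}$; that is, $\mathrm{BH}(13,10)=\emptyset$.
   Context: $\mathrm{BH}(n,q)$ denotes the set of $n\times n$ complex matrices with all entries complex $q$th roots of unity satisfying $HH^\ast=nI_n$, where $H^\ast$ is the conjugate transpose. -}

module Defs where

open import Data.Nat using (ℕ; zero; suc)
open import Data.Integer using (ℤ; +_; _+_; _*_; -_; _-_)
open import Data.Fin using (Fin; _≟_)
import Data.Fin as F
open import Relation.Nullary using (yes; no)
open import Relation.Binary.PropositionalEquality using (_≡_)
open import Data.Product using (_×_)

-- The ring ℤ[ζ] of integers of the 10th cyclotomic field, ζ = e^{2πi/10},
-- realised as ℤ[x]/(Φ₁₀(x)) with Φ₁₀(x) = x⁴ - x³ + x² - x + 1.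
-- Elements are written uniquely as c0 + c1 ζ + c2 ζ² + c3 ζ³ (c_i ∈ ℤ);
-- this is a subring of ℂ (via ζ ↦ e^{2πi/10}), so equality here is
-- equality of the corresponding complex numbers.
record Zζ : Set where
  constructor ⟨_,_,_,_⟩
  field
    c0 c1 c2 c3 : ℤ
open Zζ public

0ζ 1ζ ζ : Zζ
0ζ = ⟨ + 0 , + 0 , + 0 , + 0 ⟩
1ζ = ⟨ + 1 , + 0 , + 0 , + 0 ⟩
ζ  = ⟨ + 0 , + 1 , + 0 , + 0 ⟩

ι : ℕ → Zζ
ι n = ⟨ + n , + 0 , + 0 , + 0 ⟩

_⊕_ : Zζ → Zζ → Zζ
⟨ a0 , a1 , a2 , a3 ⟩ ⊕ ⟨ b0 , b1 , b2 , b3 ⟩ =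
  ⟨ a0 + b0 , a1 + b1 , a2 + b2 , a3 + b3 ⟩

-- multiplication, reducing with ζ⁴ = ζ³ - ζ² + ζ - 1, ζ⁵ = -1, ζ⁶ = -ζ
_⊗_ : Zζ → Zζ → Zζ
⟨ a0 , a1 , a2 , a3 ⟩ ⊗ ⟨ b0 , b1 , b2 , b3 ⟩ =
  ⟨ k0 - k4 - k5 , k1 + k4 - k6 , k2 - k4 , k3 + k4 ⟩
  where
  k0 = a0 * b0
  k1 = a0 * b1 + a1 * b0
  k2 = a0 * b2 + a1 * b1 + a2 * b0
  k3 = a0 * b3 + a1 * b2 + a2 * b1 + a3 * b0
  k4 = a1 * b3 + a2 * b2 + a3 * b1
  k5 = a2 * b3 + a3 * b2
  k6 = a3 * b3

-- complex conjugation: ζ ↦ ζ̄ = ζ⁹ = 1 - ζ + ζ² - ζ³, ζ̄² = -ζ³, ζ̄³ = -ζ²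
conj : Zζ → Zζ
conj ⟨ a , b , c , d ⟩ = ⟨ a + b , - b , b - d , - b - c ⟩

_^ζ_ : Zζ → ℕ → Zζ
x ^ζ zero = 1ζ
x ^ζ suc n = x ⊗ (x ^ζ n)

Σ[_] : (n : ℕ) → (Fin n → Zζ) → Zζ
Σ[ zero ] f = 0ζ
Σ[ suc n ] f = f F.zero ⊕ Σ[ n ] (λ i → f (F.suc i))

Matrix : ℕ → Set
Matrix n = Fin n → Fin n → Zζ

HH* : {n : ℕ} → Matrix n → Matrix n
HH* {n} H i j = Σ[ n ] (λ k → H i k ⊗ conj (H j k))

scalarI : (n m : ℕ) → Matrix n
scalarI n m i j with i ≟ j
... | yes _ = ι m
... | no _ = 0ζ

-- 10th root of unity (in ℤ[ζ₁₀] these are exactly the complex 10th roots of unity)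
IsRoot10 : Zζ → Set
IsRoot10 x = x ^ζ 10 ≡ 1ζ

IsBH10 : (n : ℕ) → Matrix n → Set
IsBH10 n H = (∀ i j → IsRoot10 (H i j)) × (∀ i j → HH* H i j ≡ scalarI n n i j)

module Submission where

-- 13 ≡ 3 has order 4 = φ(10) modulo 10, so 13 stays prime in ℤ[ζ₁₀] and ℤ[ζ]/13 is a field,
-- on which complex conjugation σ acts. Reduce a hypothetical H modulo 13 to R. Then
-- HH* = 13I gives R σ(R)ᵀ = 0: the row space W of R is orthogonal to σ(W), so 2 dim W ≤ 13.
-- Conversely, if aᵀσ(R) = 0 then aᵀH̄ = 13 w over ℤ[ζ], and multiplying by H gives a = H w;
-- so the left kernel of σ(R) lies in the column space of R, and rank–nullity gives
-- 13 ≤ 2 dim W. Hence 13 = 2 dim W, which is absurd.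

open import Defs

open import Algebra.Bundles using (CommutativeRing)
import Algebra.Properties.CommutativeSemigroup as CommutativeSemigroupProperties
import Algebra.Properties.Group as GroupProperties
import Algebra.Properties.Ring as RingProperties
import Algebra.Properties.Semiring.Sum as SemiringSum
open import Data.Fin as Fin using (Fin; zero; suc; #_; punchIn; splitAt; _↑ˡ_; _↑ʳ_)
open import Data.Fin.Properties using (all?; ¬∀⟶∃¬; punchInᵢ≢i; join-splitAt)
open import Data.Integer as ℤ using (ℤ; +_; _%ℕ_; _/ℕ_)
open import Data.Integer.DivMod using (a≡a%ℕn+[a/ℕn]*n; n%ℕd<d)
import Data.Integer.Properties as ℤ
open import Data.Integer.Solver using (module +-*-Solver)
open import Data.Nat as ℕ using (ℕ; zero; suc; z≤n; s≤s; _≤_; _<_)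
open import Data.Nat.Divisibility using (∣1⇒≡1; divides)
import Data.Nat.Properties as ℕ
open import Data.Product using (Σ; ∃; ∃₂; _×_; _,_; proj₁; proj₂; map)
open import Data.Sum using (_⊎_; inj₁; inj₂; [_,_]′)
open import Data.Sum.Properties using ([,]-map; [,]-∘)
open import Data.Vec.Functional using (Vector; _++_; tail; insertAt)
open import Data.Vec.Functional.Properties using (insertAt-lookup; insertAt-punchIn)
import Data.Vec.Functional.Relation.Binary.Equality.Setoid as VecEquality
open import Function using (_∘_; id)
open import Level using (_⊔_; 0ℓ)
open import Relation.Binary.Definitions using (DecidableEquality)
import Relation.Binary.PropositionalEquality as ≡
open ≡ using (_≡_; _≢_; _≗_)
open import Algebra.Definitions {A = Zζ} _≡_ using (Associative; Commutative; Identity; Inverse; _DistributesOver_)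
import Relation.Binary.Reasoning.Setoid as SetoidReasoning
open import Relation.Nullary using (¬_; Dec; yes; no)
open import Relation.Nullary.Decidable using (¬¬-excluded-middle; map′; _×-dec_; _⊎-dec_; toWitness)
open import Relation.Nullary.Negation using (contradiction)

-- The standard library's ¬¬-Monad is level-monomorphic; this bind is not.
module DoubleNegation where

  infixl 1 _>>=_
  _>>=_ : ∀ {a b} {A : Set a} {B : Set b} → ¬ ¬ A → (A → ¬ ¬ B) → ¬ ¬ B
  (¬¬a >>= f) ¬b = ¬¬a (λ a → f a ¬b)

  pure : ∀ {a} {A : Set a} → A → ¬ ¬ A
  pure a ¬a = ¬a a

++-suc : ∀ {a} {A : Set a} {s t} (f : Vector A (suc s)) (g : Vector A t) i → (f ++ g) (suc i) ≡ (tail f ++ g) i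
++-suc {s = s} f g i = [,]-map (splitAt s i)

++-take-drop : ∀ {a} {A : Set a} {s t} (f : Vector A (s ℕ.+ t)) → (f ∘ (_↑ˡ t)) ++ (f ∘ (s ↑ʳ_)) ≗ f
++-take-drop {s = s} {t} f i = ≡.trans (≡.sym ([,]-∘ f (splitAt s i))) (≡.cong f (join-splitAt s t i))

module QuotientRing {c ℓ} (R : CommutativeRing c ℓ) where

  open CommutativeRing R
  open RingProperties ring using (-‿distribʳ-*; -‿+-comm)
  open CommutativeSemigroupProperties +-commutativeSemigroup using (interchange)
  open CommutativeSemigroupProperties *-commutativeSemigroup using (x∙yz≈y∙xz)
  open SetoidReasoning setoid

  infix 4 _≈_mod_
  record _≈_mod_ (x y m : Carrier) : Set (c ⊔ ℓ) where
    constructor _,_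
    field
      quotient : Carrier
      proof    : x ≈ y + m * quotient

  module _ {m : Carrier} where

    ≈⇒≈mod : ∀ {x y} → x ≈ y → x ≈ y mod m
    ≈⇒≈mod {x} {y} x≈y = 0# , trans x≈y (sym (trans (+-congˡ (zeroʳ m)) (+-identityʳ y)))

    ≈mod-sym : ∀ {x y} → x ≈ y mod m → y ≈ x mod m
    ≈mod-sym {x} {y} (d , x≈y+md) = - d , (begin
      y                       ≈⟨ +-identityʳ y ⟨
      y + 0#                  ≈⟨ +-congˡ (-‿inverseʳ (m * d)) ⟨
      y + (m * d + - (m * d)) ≈⟨ +-assoc y _ _ ⟨
      (y + m * d) + - (m * d) ≈⟨ +-cong x≈y+md (sym (-‿distribʳ-* m d)) ⟨
      x + m * - d             ∎)

    ≈mod-trans : ∀ {x y z} → x ≈ y mod m → y ≈ z mod m → x ≈ z mod m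
    ≈mod-trans {x} {y} {z} (d , x≈y+md) (e , y≈z+me) = e + d , (begin
      x                   ≈⟨ x≈y+md ⟩
      y + m * d           ≈⟨ +-congʳ y≈z+me ⟩
      (z + m * e) + m * d ≈⟨ +-assoc z _ _ ⟩
      z + (m * e + m * d) ≈⟨ +-congˡ (distribˡ m e d) ⟨
      z + m * (e + d)     ∎)

    +-cong-mod : ∀ {x x′ y y′} → x ≈ x′ mod m → y ≈ y′ mod m → x + y ≈ x′ + y′ mod m
    +-cong-mod {x} {x′} {y} {y′} (d , x≈) (e , y≈) = d + e , (begin
      x + y                           ≈⟨ +-cong x≈ y≈ ⟩
      (x′ + m * d) + (y′ + m * e)     ≈⟨ interchange x′ _ y′ _ ⟩
      (x′ + y′) + (m * d + m * e)     ≈⟨ +-congˡ (distribˡ m d e) ⟨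
      (x′ + y′) + m * (d + e)         ∎)

    *-cong-mod : ∀ {x x′ y y′} → x ≈ x′ mod m → y ≈ y′ mod m → x * y ≈ x′ * y′ mod m
    *-cong-mod {x} {x′} {y} {y′} (d , x≈) (e , y≈) = x′ * e + d * y , (begin
      x * y                                  ≈⟨ *-congʳ x≈ ⟩
      (x′ + m * d) * y                       ≈⟨ distribʳ y x′ (m * d) ⟩
      x′ * y + (m * d) * y                   ≈⟨ +-cong (*-congˡ y≈) (*-assoc m d y) ⟩
      x′ * (y′ + m * e) + m * (d * y)        ≈⟨ +-congʳ (distribˡ x′ y′ (m * e)) ⟩
      (x′ * y′ + x′ * (m * e)) + m * (d * y) ≈⟨ +-congʳ (+-congˡ (x∙yz≈y∙xz x′ m e)) ⟩
      (x′ * y′ + m * (x′ * e)) + m * (d * y) ≈⟨ +-assoc _ _ _ ⟩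
      x′ * y′ + (m * (x′ * e) + m * (d * y)) ≈⟨ +-congˡ (distribˡ m _ _) ⟨
      x′ * y′ + m * (x′ * e + d * y)         ∎)

    -‿cong-mod : ∀ {x x′} → x ≈ x′ mod m → - x ≈ - x′ mod m
    -‿cong-mod {x} {x′} (d , x≈) = - d , (begin
      - x                  ≈⟨ -‿cong x≈ ⟩
      - (x′ + m * d)       ≈⟨ -‿+-comm x′ (m * d) ⟨
      - x′ + - (m * d)     ≈⟨ +-congˡ (-‿distribʳ-* m d) ⟩
      - x′ + m * - d       ∎)

  quotientRing : Carrier → CommutativeRing c (c ⊔ ℓ)
  quotientRing m = record
    { Carrier = Carrier ; _≈_ = _≈_mod m ; _+_ = _+_ ; _*_ = _*_ ; -_ = -_ ; 0# = 0# ; 1# = 1#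
    ; isCommutativeRing = record
      { isRing = record
        { +-isAbelianGroup = record
          { isGroup = record
            { isMonoid = record
              { isSemigroup = record
                { isMagma = record
                  { isEquivalence = record { refl = ≈⇒≈mod refl ; sym = ≈mod-sym ; trans = ≈mod-trans }
                  ; ∙-cong = +-cong-mod }
                ; assoc = λ x y z → ≈⇒≈mod (+-assoc x y z) }
              ; identity = ≈⇒≈mod ∘ +-identityˡ , ≈⇒≈mod ∘ +-identityʳ }
            ; inverse = ≈⇒≈mod ∘ -‿inverseˡ , ≈⇒≈mod ∘ -‿inverseʳ
            ; ⁻¹-cong = -‿cong-mod }
          ; comm = λ x y → ≈⇒≈mod (+-comm x y) }
        ; *-cong = *-cong-mod
        ; *-assoc = λ x y z → ≈⇒≈mod (*-assoc x y z)
        ; *-identity = ≈⇒≈mod ∘ *-identityˡ , ≈⇒≈mod ∘ *-identityʳ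
        ; distrib = (λ x y z → ≈⇒≈mod (distribˡ x y z)) , (λ x y z → ≈⇒≈mod (distribʳ x y z)) }
      ; *-comm = λ x y → ≈⇒≈mod (*-comm x y) } }

module LinearCombinations {c ℓ} (K : CommutativeRing c ℓ) where

  open CommutativeRing K hiding (zero)
  open RingProperties ring using (-‿distribˡ-*; -‿+-comm; -0#≈0#)
  open SemiringSum semiring using (sum; sum-cong-≋; sum-replicate-zero; sum-remove; ∑-comm; *-distribˡ-sum; *-distribʳ-sum)
  open CommutativeSemigroupProperties +-commutativeSemigroup using () renaming (xy∙z≈y∙xz to xy+z≈y+xz)
  open CommutativeSemigroupProperties *-commutativeSemigroup using (x∙yz≈y∙xz)
  open import Data.Vec.Functional using ([]; _∷_)
  open VecEquality setoid using (_≋_)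
  open SetoidReasoning setoid

  Family : ℕ → ℕ → Set c
  Family m n = Vector (Vector Carrier n) m

  0⃗ : ∀ {n} → Vector Carrier n
  0⃗ _ = 0#

  combination : ∀ {m n} → Vector Carrier m → Family m n → Vector Carrier n
  combination a v k = sum (λ i → a i * v i k)

  infix 7 _∙_
  _∙_ : ∀ {n} → Vector Carrier n → Vector Carrier n → Carrier
  u ∙ w = sum (λ k → u k * w k)

  infix 4 _∈span_
  _∈span_ : ∀ {m n} → Vector Carrier n → Family m n → Set (c ⊔ ℓ)
  u ∈span v = ∃ λ a → u ≋ combination a v

  Independent : ∀ {m n} → Family m n → Set (c ⊔ ℓ)
  Independent v = ∀ a → combination a v ≋ 0⃗ → a ≋ 0⃗

  basis : ∀ {n} → Family n n
  basis i k with i Fin.≟ k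
  ... | yes _ = 1#
  ... | no _  = 0#

  basis-diagonal : ∀ {n} (i : Fin n) → basis i i ≈ 1#
  basis-diagonal i with i Fin.≟ i
  ... | yes _  = refl
  ... | no i≢i = contradiction ≡.refl i≢i

  basis-off-diagonal : ∀ {n} {i k : Fin n} → i ≢ k → basis i k ≈ 0#
  basis-off-diagonal {i = i} {k} i≢k with i Fin.≟ k
  ... | yes i≡k = contradiction i≡k i≢k
  ... | no _    = refl

  sum-≈0 : ∀ {n} {f : Vector Carrier n} → (∀ i → f i ≈ 0#) → sum f ≈ 0#
  sum-≈0 {n} f≈0 = trans (sum-cong-≋ f≈0) (sum-replicate-zero n)

  sum-supported : ∀ {n} (f : Vector Carrier n) i → (∀ j → j ≢ i → f j ≈ 0#) → sum f ≈ f i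
  sum-supported {suc n} f i f≈0 = begin
    sum f                      ≈⟨ sum-remove f ⟩
    f i + sum (f ∘ punchIn i)  ≈⟨ +-congˡ (sum-≈0 (λ j → f≈0 _ (punchInᵢ≢i i j))) ⟩
    f i + 0#                   ≈⟨ +-identityʳ (f i) ⟩
    f i                        ∎

  sum-neg : ∀ {n} (f : Vector Carrier n) → sum (λ i → - f i) ≈ - sum f
  sum-neg {zero}  f = sym -0#≈0#
  sum-neg {suc n} f = trans (+-congˡ (sum-neg (f ∘ suc))) (-‿+-comm (f zero) (sum (f ∘ suc)))

  combination-basis : ∀ {n} (a : Vector Carrier n) → combination a basis ≋ a
  combination-basis a k =
    trans (sum-supported _ k (λ j j≢k → trans (*-congˡ (basis-off-diagonal j≢k)) (zeroʳ (a j))))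
          (trans (*-congˡ (basis-diagonal k)) (*-identityʳ (a k)))

  ∙-basis : ∀ {n} (x : Vector Carrier n) k → x ∙ basis k ≈ x k
  ∙-basis x k =
    trans (sum-supported _ k (λ j j≢k → trans (*-congˡ (basis-off-diagonal (j≢k ∘ ≡.sym))) (zeroʳ (x j))))
          (trans (*-congˡ (basis-diagonal k)) (*-identityʳ (x k)))

  combination-selects : ∀ {m n} (v : Family m n) i → combination (basis i) v ≋ v i
  combination-selects v i k = trans (sum-cong-≋ (λ j → *-comm (basis i j) (v j k))) (∙-basis (λ j → v j k) i)

  combination-cong : ∀ {m n} {a b : Vector Carrier m} (v : Family m n) → a ≋ b → combination a v ≋ combination b v
  combination-cong v a≋b k = sum-cong-≋ (λ i → *-congʳ (a≋b i))

  combination-0⃗ : ∀ {m n} (v : Family m n) → combination 0⃗ v ≋ 0⃗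
  combination-0⃗ v k = sum-≈0 (λ i → zeroˡ (v i k))

  combination-neg : ∀ {m n} (a : Vector Carrier m) (v : Family m n) k →
                    combination (λ i → - a i) v k ≈ - combination a v k
  combination-neg a v k = begin
    sum (λ i → - a i * v i k)    ≈⟨ sum-cong-≋ (λ i → -‿distribˡ-* (a i) (v i k)) ⟨
    sum (λ i → - (a i * v i k))  ≈⟨ sum-neg (λ i → a i * v i k) ⟩
    - sum (λ i → a i * v i k)    ∎

  combination-of-combinations :
    ∀ {m l n} {v : Family m n} {w : Family l n} (C : Family m l) →
    (∀ i → v i ≋ combination (C i) w) → ∀ a → combination a v ≋ combination (combination a C) w
  combination-of-combinations {v = v} {w} C v≋Cw a k = begin
    sum (λ i → a i * v i k)
      ≈⟨ sum-cong-≋ (λ i → *-congˡ (v≋Cw i k)) ⟩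
    sum (λ i → a i * sum (λ j → C i j * w j k))
      ≈⟨ sum-cong-≋ (λ i → *-distribˡ-sum (a i) (λ j → C i j * w j k)) ⟩
    sum (λ i → sum (λ j → a i * (C i j * w j k)))
      ≈⟨ ∑-comm (λ i j → a i * (C i j * w j k)) ⟩
    sum (λ j → sum (λ i → a i * (C i j * w j k)))
      ≈⟨ sum-cong-≋ (λ j → sum-cong-≋ (λ i → *-assoc (a i) (C i j) (w j k))) ⟨
    sum (λ j → sum (λ i → (a i * C i j) * w j k))
      ≈⟨ sum-cong-≋ (λ j → *-distribʳ-sum (w j k) (λ i → a i * C i j)) ⟨
    sum (λ j → sum (λ i → a i * C i j) * w j k)
      ∎

  combination-∈span : ∀ {m n} (a : Vector Carrier m) (v : Family m n) → combination a v ∈span v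
  combination-∈span a v = a , λ _ → refl

  ∈span-member : ∀ {m n} (v : Family m n) i → v i ∈span v
  ∈span-member v i = basis i , λ k → sym (combination-selects v i k)

  ∈span-basis : ∀ {n} (u : Vector Carrier n) → u ∈span basis
  ∈span-basis u = u , λ k → sym (combination-basis u k)

  ∈span-trans : ∀ {m l n} {u : Vector Carrier n} {v : Family m n} {w : Family l n} →
                u ∈span v → (∀ i → v i ∈span w) → u ∈span w
  ∈span-trans {w = w} (a , u≋a·v) v⊆w =
    combination a (proj₁ ∘ v⊆w) ,
    λ k → trans (u≋a·v k) (combination-of-combinations {w = w} (proj₁ ∘ v⊆w) (proj₂ ∘ v⊆w) a k)

  independent-basis : ∀ {n} → Independent (basis {n})
  independent-basis a a·basis≋0 k = trans (sym (combination-basis a k)) (a·basis≋0 k)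

  ∙-combination : ∀ {m n} (x : Vector Carrier n) (a : Vector Carrier m) (v : Family m n) →
                  x ∙ combination a v ≈ sum (λ i → a i * (x ∙ v i))
  ∙-combination x a v = begin
    sum (λ k → x k * sum (λ i → a i * v i k))
      ≈⟨ sum-cong-≋ (λ k → *-distribˡ-sum (x k) (λ i → a i * v i k)) ⟩
    sum (λ k → sum (λ i → x k * (a i * v i k)))
      ≈⟨ ∑-comm (λ k i → x k * (a i * v i k)) ⟩
    sum (λ i → sum (λ k → x k * (a i * v i k)))
      ≈⟨ sum-cong-≋ (λ i → sum-cong-≋ (λ k → x∙yz≈y∙xz (x k) (a i) (v i k))) ⟩
    sum (λ i → sum (λ k → a i * (x k * v i k)))
      ≈⟨ sum-cong-≋ (λ i → *-distribˡ-sum (a i) (λ k → x k * v i k)) ⟨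
    sum (λ i → a i * (x ∙ v i))
      ∎

  combination-∙ : ∀ {m n} (a : Vector Carrier m) (v : Family m n) (x : Vector Carrier n) →
                  combination a v ∙ x ≈ sum (λ i → a i * (v i ∙ x))
  combination-∙ a v x =
    trans (sum-cong-≋ (λ k → *-comm _ (x k)))
          (trans (∙-combination x a v) (sum-cong-≋ (λ i → *-congˡ (sum-cong-≋ (λ k → *-comm (x k) (v i k))))))

  columns : ∀ {m d} → Family m d → Family d m
  columns C b i = C i b

  ∙-∈span-columns : ∀ {m d n} {R : Family m n} {T : Family d n} (C : Family m d) →
                    (∀ i → R i ≋ combination (C i) T) → ∀ w → (λ i → R i ∙ w) ∈span columns C
  ∙-∈span-columns {R = R} {T} C R≋C·T w = (λ b → T b ∙ w) , λ i → begin
    R i ∙ w                        ≈⟨ sum-cong-≋ (λ k → *-congʳ (R≋C·T i k)) ⟩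
    combination (C i) T ∙ w        ≈⟨ combination-∙ (C i) T w ⟩
    sum (λ b → C i b * (T b ∙ w))  ≈⟨ sum-cong-≋ (λ b → *-comm (C i b) (T b ∙ w)) ⟩
    sum (λ b → (T b ∙ w) * C i b)  ∎

  ∙-*ʳ : ∀ {n} (x y : Vector Carrier n) c → x ∙ (λ k → c * y k) ≈ c * (x ∙ y)
  ∙-*ʳ x y c = trans (sum-cong-≋ (λ k → x∙yz≈y∙xz (x k) c (y k))) (sym (*-distribˡ-sum c (λ k → x k * y k)))

  -- Families given in two parts S, T, so that a vector can move from S to T without reindexing.

  Independent₂ : ∀ {s t n} → Family s n → Family t n → Set (c ⊔ ℓ)
  Independent₂ S T = ∀ a b → (∀ k → combination a S k + combination b T k ≈ 0#) → a ≋ 0⃗ × b ≋ 0⃗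

  infix 4 _∈span₂_
  _∈span₂_ : ∀ {s t n} → Vector Carrier n → Family s n × Family t n → Set (c ⊔ ℓ)
  u ∈span₂ (S , T) = ∃₂ λ a b → ∀ k → u k ≈ combination a S k + combination b T k

  combination-++ : ∀ {s t n} (a : Vector Carrier s) (b : Vector Carrier t) (S : Family s n) (T : Family t n) k →
                   combination (a ++ b) (S ++ T) k ≈ combination a S k + combination b T k
  combination-++ {zero}  a b S T k = sym (+-identityˡ _)
  combination-++ {suc s} a b S T k = begin
    a zero * S zero k + sum (λ i → (a ++ b) (suc i) * (S ++ T) (suc i) k)
      ≈⟨ +-congˡ (sum-cong-≋ (λ i → reflexive (≡.cong₂ (λ x y → x * y k) (++-suc a b i) (++-suc S T i)))) ⟩
    a zero * S zero k + combination (tail a ++ b) (tail S ++ T) k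
      ≈⟨ +-congˡ (combination-++ (tail a) b (tail S) T k) ⟩
    a zero * S zero k + (combination (tail a) (tail S) k + combination b T k)
      ≈⟨ +-assoc _ _ _ ⟨
    combination a S k + combination b T k
      ∎

  independent₂⇒independent-++ : ∀ {s t n} {S : Family s n} {T : Family t n} →
                                Independent₂ S T → Independent (S ++ T)
  independent₂⇒independent-++ {s} {t} {S = S} {T} independent c c·ST≋0 i =
    trans (reflexive (≡.sym (++-take-drop {s = s} {t} c i))) (in-part (splitAt s i))
    where
    parts≋0 : c ∘ (_↑ˡ t) ≋ 0⃗ × c ∘ (s ↑ʳ_) ≋ 0⃗
    parts≋0 = independent (c ∘ (_↑ˡ t)) (c ∘ (s ↑ʳ_)) λ k → begin
      combination (c ∘ (_↑ˡ t)) S k + combination (c ∘ (s ↑ʳ_)) T k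
        ≈⟨ combination-++ _ _ S T k ⟨
      combination ((c ∘ (_↑ˡ t)) ++ (c ∘ (s ↑ʳ_))) (S ++ T) k
        ≈⟨ sum-cong-≋ (λ i → *-congʳ (reflexive (++-take-drop {s = s} {t} c i))) ⟩
      combination c (S ++ T) k
        ≈⟨ c·ST≋0 k ⟩
      0#
        ∎
    in-part : ∀ x → [ c ∘ (_↑ˡ t) , c ∘ (s ↑ʳ_) ]′ x ≈ 0#
    in-part (inj₁ j) = proj₁ parts≋0 j
    in-part (inj₂ j) = proj₂ parts≋0 j

  ∈span₂⇒∈span-++ : ∀ {s t n} {u : Vector Carrier n} {S : Family s n} {T : Family t n} →
                    u ∈span₂ (S , T) → u ∈span (S ++ T)
  ∈span₂⇒∈span-++ {S = S} {T} (a , b , u≈) = a ++ b , λ k → trans (u≈ k) (sym (combination-++ a b S T k))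

  independent₂-[]⁺ : ∀ {s n} {S : Family s n} → Independent S → Independent₂ S []
  independent₂-[]⁺ independent a b a·S≈0 = independent a (λ k → trans (sym (+-identityʳ _)) (a·S≈0 k)) , λ ()

  independent₂-[]⁻ : ∀ {t n} {T : Family t n} → Independent₂ [] T → Independent T
  independent₂-[]⁻ independent b b·T≋0 = proj₂ (independent (λ ()) b (λ k → trans (+-identityˡ _) (b·T≋0 k)))

  ∈span₂-[]⁻ : ∀ {t n} {u : Vector Carrier n} {T : Family t n} → u ∈span₂ ([] , T) → u ∈span T
  ∈span₂-[]⁻ (_ , b , u≈) = b , λ k → trans (u≈ k) (+-identityˡ _)

  ∈span⇒∈span₂ : ∀ {s t n} {u : Vector Carrier n} {S : Family s n} {T : Family t n} →
                 u ∈span S → u ∈span₂ (S , T)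
  ∈span⇒∈span₂ {T = T} (a , u≋a·S) = a , 0⃗ , λ k →
    trans (u≋a·S k) (sym (trans (+-congˡ (combination-0⃗ T k)) (+-identityʳ _)))

  ∈span₂-head : ∀ {s t n} {u : Vector Carrier n} {S : Family s n} {T : Family t n} → u ∈span₂ (S , u ∷ T)
  ∈span₂-head {u = u} {S} {T} =
    0⃗ , basis zero , λ k →
    sym (trans (+-cong (combination-0⃗ S k) (combination-selects (u ∷ T) zero k)) (+-identityˡ _))

  independent₂-move : ∀ {s t n} {u : Vector Carrier n} {S : Family s n} {T : Family t n} →
                      Independent₂ (u ∷ S) T → Independent₂ S (u ∷ T)
  independent₂-move independent a b a·S+b·uT≈0
    with independent (b zero ∷ a) (tail b) (λ k → trans (xy+z≈y+xz _ _ _) (a·S+b·uT≈0 k))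
  ... | ba≋0 , tail-b≋0 = ba≋0 ∘ suc , λ where
    zero    → ba≋0 zero
    (suc j) → tail-b≋0 j

  ∈span₂-move : ∀ {s t n} {u w : Vector Carrier n} {S : Family s n} {T : Family t n} →
                w ∈span₂ (u ∷ S , T) → w ∈span₂ (S , u ∷ T)
  ∈span₂-move (a , b , w≈) = tail a , a zero ∷ b , λ k → trans (w≈ k) (xy+z≈y+xz _ _ _)

record IsDiscreteField {c ℓ} (K : CommutativeRing c ℓ) : Set (c ⊔ ℓ) where
  open CommutativeRing K
  field
    1≉0                : 1# ≉ 0#
    zero-or-invertible : ∀ x → x ≈ 0# ⊎ ∃ λ y → x * y ≈ 1#

module LinearAlgebra {c ℓ} (K : CommutativeRing c ℓ) (isDiscreteField : IsDiscreteField K) where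

  open CommutativeRing K hiding (zero)
  open IsDiscreteField isDiscreteField

  open LinearCombinations K
  open DoubleNegation
  open import Data.Vec.Functional using ([]; _∷_)
  open SemiringSum semiring using (sum; sum-cong-≋; sum-remove; ∑-distrib-+; *-distribˡ-sum; *-distribʳ-sum)
  open RingProperties ring using (-‿distribˡ-*; -‿distribʳ-*)
  open GroupProperties +-group using (inverseˡ-unique; identityˡ-unique)
  open VecEquality setoid using (_≋_)
  open SetoidReasoning setoid

  ≈0? : ∀ x → Dec (x ≈ 0#)
  ≈0? x with zero-or-invertible x
  ... | inj₁ x≈0        = yes x≈0
  ... | inj₂ (y , xy≈1) = no λ x≈0 → 1≉0 (begin
    1#      ≈⟨ xy≈1 ⟨
    x * y   ≈⟨ *-congʳ x≈0 ⟩
    0# * y  ≈⟨ zeroˡ y ⟩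
    0#      ∎)

  *-cancelʳ-≈0 : ∀ {x y} → x * y ≈ 0# → y ≉ 0# → x ≈ 0#
  *-cancelʳ-≈0 {x} {y} xy≈0 y≉0 with zero-or-invertible y
  ... | inj₁ y≈0        = contradiction y≈0 y≉0
  ... | inj₂ (z , yz≈1) = begin
    x            ≈⟨ *-identityʳ x ⟨
    x * 1#       ≈⟨ *-congˡ yz≈1 ⟨
    x * (y * z)  ≈⟨ *-assoc x y z ⟨
    (x * y) * z  ≈⟨ *-congʳ xy≈0 ⟩
    0# * z       ≈⟨ zeroˡ z ⟩
    0#           ∎

  independent-tail : ∀ {m n} {v : Family m (suc n)} → (∀ i → v i zero ≈ 0#) →
                     Independent v → Independent (tail ∘ v)
  independent-tail v·0≈0 independent a a·tailv≋0 = independent a λ where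
    zero    → sum-≈0 (λ i → trans (*-congˡ (v·0≈0 i)) (zeroʳ (a i)))
    (suc k) → a·tailv≋0 k

  eliminate : ∀ {m n} → Family (suc m) (suc n) → Fin (suc m) → Family m (suc n)
  eliminate v p i k = v p zero * v (punchIn p i) k - v (punchIn p i) zero * v p k

  eliminate-zero : ∀ {m n} (v : Family (suc m) (suc n)) p i → eliminate v p i zero ≈ 0#
  eliminate-zero v p i = trans (+-congˡ (-‿cong (*-comm _ _))) (-‿inverseʳ _)

  combination-eliminate :
    ∀ {m n} (v : Family (suc m) (suc n)) p (a : Vector Carrier m) →
    let S = sum (λ i → a i * v (punchIn p i) zero) in
    combination (insertAt (λ i → a i * v p zero) p (- S)) v ≋ combination a (eliminate v p)
  combination-eliminate v p a k = begin
    combination b v k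
      ≈⟨ sum-remove {i = p} (λ j → b j * v j k) ⟩
    b p * v p k + sum (λ i → b (punchIn p i) * v (punchIn p i) k)
      ≈⟨ +-cong (*-congʳ (reflexive (insertAt-lookup a′ p (- S))))
                (sum-cong-≋ (λ i → *-congʳ (reflexive (insertAt-punchIn a′ p (- S) i)))) ⟩
    - S * v p k + sum (λ i → a′ i * v (punchIn p i) k)
      ≈⟨ +-comm _ _ ⟩
    sum (λ i → a′ i * v (punchIn p i) k) + - S * v p k
      ≈⟨ +-cong (sum-cong-≋ (λ i → *-assoc (a i) _ _)) (sym (-‿distribˡ-* S (v p k))) ⟩
    sum (λ i → a i * (v p zero * v (punchIn p i) k)) + - (S * v p k)
      ≈⟨ +-congˡ (-‿cong (*-distribʳ-sum (v p k) (λ i → a i * v (punchIn p i) zero))) ⟩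
    sum (λ i → a i * (v p zero * v (punchIn p i) k)) + - sum (λ i → a i * v (punchIn p i) zero * v p k)
      ≈⟨ +-congˡ (sum-neg (λ i → a i * v (punchIn p i) zero * v p k)) ⟨
    sum (λ i → a i * (v p zero * v (punchIn p i) k)) + sum (λ i → - (a i * v (punchIn p i) zero * v p k))
      ≈⟨ +-congˡ (sum-cong-≋ (λ i → trans (-‿cong (*-assoc (a i) _ _)) (-‿distribʳ-* (a i) _))) ⟩
    sum (λ i → a i * (v p zero * v (punchIn p i) k)) + sum (λ i → a i * - (v (punchIn p i) zero * v p k))
      ≈⟨ ∑-distrib-+ (λ i → a i * (v p zero * v (punchIn p i) k))
                     (λ i → a i * - (v (punchIn p i) zero * v p k)) ⟨
    sum (λ i → a i * (v p zero * v (punchIn p i) k) + a i * - (v (punchIn p i) zero * v p k))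
      ≈⟨ sum-cong-≋ (λ i → distribˡ (a i) _ _) ⟨
    combination a (eliminate v p) k
      ∎
    where
    a′ = λ i → a i * v p zero
    S  = sum (λ i → a i * v (punchIn p i) zero)
    b  = insertAt a′ p (- S)

  eliminate-independent : ∀ {m n} {v : Family (suc m) (suc n)} {p} → v p zero ≉ 0# →
                          Independent v → Independent (eliminate v p)
  eliminate-independent {v = v} {p} pivot≉0 independent a a·w≋0 i =
    *-cancelʳ-≈0 (trans (reflexive (≡.sym (insertAt-punchIn a′ p (- S) i))) (b≋0 (punchIn p i))) pivot≉0
    where
    a′ = λ i → a i * v p zero
    S  = sum (λ i → a i * v (punchIn p i) zero)
    b≋0 : insertAt a′ p (- S) ≋ 0⃗
    b≋0 = independent (insertAt a′ p (- S)) λ k → trans (combination-eliminate v p a k) (a·w≋0 k)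

  independent-≤-dim : ∀ {m n} (v : Family m n) → Independent v → m ≤ n
  independent-≤-dim {zero}          v _           = z≤n
  independent-≤-dim {suc m} {zero}  v independent = contradiction (independent (λ _ → 1#) (λ ()) zero) 1≉0
  independent-≤-dim {suc m} {suc n} v independent with all? (λ i → ≈0? (v i zero))
  ... | yes column≈0 =
    ℕ.m≤n⇒m≤1+n (independent-≤-dim (tail ∘ v) (independent-tail {v = v} column≈0 independent))
  ... | no ¬column≈0 =
    s≤s (independent-≤-dim (tail ∘ eliminate v p)
          (independent-tail {v = eliminate v p} (eliminate-zero v p)
            (eliminate-independent {v = v} {p} pivot≉0 independent)))
    where
    pivot   = ¬∀⟶∃¬ _ _ (λ i → ≈0? (v i zero)) ¬column≈0
    p       = proj₁ pivot
    pivot≉0 = proj₂ pivot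

  independent-≤-spanning : ∀ {m l n} (v : Family m n) {w : Family l n} →
                           Independent v → (∀ i → v i ∈span w) → m ≤ l
  independent-≤-spanning v {w} independent v⊆w = independent-≤-dim C C-independent
    where
    C = proj₁ ∘ v⊆w
    C-independent : Independent C
    C-independent a a·C≋0 = independent a λ k → begin
      combination a v k                  ≈⟨ combination-of-combinations C (proj₂ ∘ v⊆w) a k ⟩
      combination (combination a C) w k  ≈⟨ combination-cong w a·C≋0 k ⟩
      combination 0⃗ w k                 ≈⟨ combination-0⃗ w k ⟩
      0#                                 ∎

  independent-∷ : ∀ {s n} {S : Family s n} {u : Vector Carrier n} →
                  Independent S → ¬ u ∈span S → Independent (u ∷ S)
  independent-∷ {S = S} {u} independent u∉S a a·uS≋0 with zero-or-invertible (a zero)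
  ... | inj₁ a₀≈0 = λ where
    zero    → a₀≈0
    (suc i) → independent (tail a) (λ k → begin
      combination (tail a) S k                    ≈⟨ +-identityˡ _ ⟨
      0# + combination (tail a) S k               ≈⟨ +-congʳ (trans (*-congʳ a₀≈0) (zeroˡ (u k))) ⟨
      a zero * u k + combination (tail a) S k     ≈⟨ a·uS≋0 k ⟩
      0#                                          ∎) i
  ... | inj₂ (y , a₀y≈1) = contradiction ((λ i → - y * a (suc i)) , u≋) u∉S
    where
    u≋ : u ≋ combination (λ i → - y * a (suc i)) S
    u≋ k = begin
      u k                                          ≈⟨ *-identityˡ (u k) ⟨
      1# * u k                                     ≈⟨ *-congʳ (trans (sym a₀y≈1) (*-comm _ y)) ⟩
      (y * a zero) * u k                           ≈⟨ *-assoc y _ _ ⟩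
      y * (a zero * u k)                           ≈⟨ *-congˡ (inverseˡ-unique _ _ (a·uS≋0 k)) ⟩
      y * - combination (tail a) S k               ≈⟨ -‿distribʳ-* y _ ⟨
      - (y * combination (tail a) S k)             ≈⟨ -‿distribˡ-* y _ ⟩
      - y * combination (tail a) S k               ≈⟨ *-distribˡ-sum (- y) (λ i → a (suc i) * S i k) ⟩
      sum (λ i → - y * (a (suc i) * S i k))        ≈⟨ sum-cong-≋ (λ i → *-assoc (- y) (a (suc i)) (S i k)) ⟨
      combination (λ i → - y * a (suc i)) S k      ∎

  Extension : ∀ {s m n} → Family s n → Family m n → Set (c ⊔ ℓ)
  Extension {n = n} S v = ∃₂ λ t (T : Family t n) →
    Independent₂ S T × (∀ j → v j ∈span₂ (S , T)) × (∀ j → ∃ λ i → T j ≡ v i)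

  extend : ∀ {s m n} {S : Family s n} → Independent S → (v : Family m n) → ¬ ¬ Extension S v
  extend {m = zero} S-independent v = pure (0 , [] , independent₂-[]⁺ S-independent , (λ ()) , (λ ()))
  extend {m = suc _} {S = S} S-independent v = ¬¬-excluded-middle {A = v zero ∈span S} >>= λ where
    (yes v₀∈S) → do
      (t , T , independent , spanning , T⊆v) ← extend S-independent (tail v)
      pure (t , T , independent , (λ { zero → ∈span⇒∈span₂ v₀∈S ; (suc j) → spanning j }) , map suc id ∘ T⊆v)
    (no v₀∉S) → do
      (t , T , independent , spanning , T⊆v) ← extend {S = v zero ∷ S} (independent-∷ S-independent v₀∉S) (tail v)
      pure ( suc t , v zero ∷ T , independent₂-move independent
           , (λ { zero → ∈span₂-head ; (suc j) → ∈span₂-move (spanning j) })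
           , (λ { zero → zero , ≡.refl ; (suc j) → map suc id (T⊆v j) }))

  independent-subfamily : ∀ {m n} (v : Family m n) → ¬ ¬ ∃₂ λ t (T : Family t n) →
    Independent T × (∀ j → v j ∈span T) × (∀ j → ∃ λ i → T j ≡ v i)
  independent-subfamily v = do
    (t , T , independent , spanning , T⊆v) ← extend {S = []} (λ _ _ ()) v
    pure (t , T , independent₂-[]⁻ independent , ∈span₂-[]⁻ ∘ spanning , T⊆v)

  orthogonal⇒≋0 : ∀ {s t n} {S : Family s n} {T : Family t n} {x : Vector Carrier n} →
                  (∀ k → basis k ∈span₂ (S , T)) → (∀ i → x ∙ S i ≈ 0#) → (∀ j → x ∙ T j ≈ 0#) → x ≋ 0⃗
  orthogonal⇒≋0 {S = S} {T} {x} spanning x⊥S x⊥T k = let (a , b , e≈) = spanning k in begin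
    x k
      ≈⟨ ∙-basis x k ⟨
    x ∙ basis k
      ≈⟨ sum-cong-≋ (λ l → *-congˡ (e≈ l)) ⟩
    x ∙ (λ l → combination a S l + combination b T l)
      ≈⟨ sum-cong-≋ (λ l → distribˡ (x l) _ _) ⟩
    sum (λ l → x l * combination a S l + x l * combination b T l)
      ≈⟨ ∑-distrib-+ (λ l → x l * combination a S l) (λ l → x l * combination b T l) ⟩
    x ∙ combination a S + x ∙ combination b T
      ≈⟨ +-cong (∙-combination x a S) (∙-combination x b T) ⟩
    sum (λ i → a i * (x ∙ S i)) + sum (λ j → b j * (x ∙ T j))
      ≈⟨ +-cong (sum-≈0 (λ i → trans (*-congˡ (x⊥S i)) (zeroʳ (a i))))
                (sum-≈0 (λ j → trans (*-congˡ (x⊥T j)) (zeroʳ (b j)))) ⟩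
    0# + 0#
      ≈⟨ +-identityˡ 0# ⟩
    0#
      ∎

  orthogonal-dimensions : ∀ {p s n} {a : Family p n} {u : Family s n} →
                          Independent a → Independent u → (∀ i j → a i ∙ u j ≈ 0#) → ¬ ¬ (p ℕ.+ s ≤ n)
  orthogonal-dimensions {s = s} {a = a} {u} a-independent u-independent a⊥u = do
    (t , T , uT-independent , basis⊆uT , _) ← extend u-independent basis
    let s+t≤n = independent-≤-spanning (u ++ T) (independent₂⇒independent-++ uT-independent) (∈span-basis ∘ (u ++ T))
        p≤t   = independent-≤-dim (λ i j → a i ∙ T j) λ c h → a-independent c
                  (orthogonal⇒≋0 basis⊆uT
                    (λ i → trans (combination-∙ c a (u i)) (sum-≈0 (λ l → trans (*-congˡ (a⊥u l i)) (zeroʳ (c l)))))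
                    (λ j → trans (combination-∙ c a (T j)) (h j)))
    pure (ℕ.≤-trans (ℕ.≤-trans (ℕ.+-monoˡ-≤ s p≤t) (ℕ.≤-reflexive (ℕ.+-comm t s))) s+t≤n)

  rank-nullity : ∀ {m n p q} (M : Family m n) {P : Family p m} {Q : Family q n} →
                 (∀ a → combination a M ≋ 0⃗ → a ∈span P) → (∀ i → M i ∈span Q) → ¬ ¬ (m ≤ p ℕ.+ q)
  rank-nullity M {P} kernel⊆P rows⊆Q = do
    (y , Y , Y-independent , P⊆Y , Y⊆P) ← independent-subfamily P
    (z , Z , YZ-independent , basis⊆YZ , _) ← extend Y-independent basis
    let y≤p   = independent-≤-spanning Y Y-independent λ j →
                  ≡.subst (_∈span P) (≡.sym (proj₂ (Y⊆P j))) (∈span-member P (proj₁ (Y⊆P j)))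
        m≤y+z = independent-≤-spanning basis independent-basis (∈span₂⇒∈span-++ ∘ basis⊆YZ)
        z≤q   = independent-≤-spanning (λ j → combination (Z j) M) (image-independent YZ-independent P⊆Y)
                  (λ j → ∈span-trans (combination-∈span (Z j) M) rows⊆Q)
    pure (ℕ.≤-trans m≤y+z (ℕ.+-mono-≤ y≤p z≤q))
    where
    image-independent : ∀ {y z} {Y : Family y _} {Z : Family z _} → Independent₂ Y Z → (∀ i → P i ∈span Y) →
                        Independent (λ j → combination (Z j) M)
    image-independent {Y = Y} {Z} YZ-independent P⊆Y μ μ·MZ≋0 = proj₂ (YZ-independent (λ i → - β i) μ λ k → begin
      combination (λ i → - β i) Y k + combination μ Z k ≈⟨ +-congʳ (combination-neg β Y k) ⟩
      - combination β Y k + combination μ Z k          ≈⟨ +-congʳ (-‿cong (ν≋β·Y k)) ⟨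
      - combination μ Z k + combination μ Z k          ≈⟨ -‿inverseˡ _ ⟩
      0#                                               ∎)
      where
      ν∈P : combination μ Z ∈span P
      ν∈P = kernel⊆P (combination μ Z) λ k →
              trans (sym (combination-of-combinations {w = M} Z (λ _ _ → refl) μ k)) (μ·MZ≋0 k)
      β = proj₁ (∈span-trans ν∈P P⊆Y)
      ν≋β·Y = proj₂ (∈span-trans ν∈P P⊆Y)

  module _ (σ : Carrier → Carrier) (σ-cong : ∀ {x y} → x ≈ y → σ x ≈ σ y)
           (σ-+ : ∀ x y → σ (x + y) ≈ σ x + σ y) (σ-* : ∀ x y → σ (x * y) ≈ σ x * σ y)
           (σ-involutive : ∀ x → σ (σ x) ≈ x) where

    σ-0 : σ 0# ≈ 0#
    σ-0 = identityˡ-unique (σ 0#) (σ 0#) (trans (sym (σ-+ 0# 0#)) (σ-cong (+-identityˡ 0#)))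

    σ-sum : ∀ {n} (f : Vector Carrier n) → σ (sum f) ≈ sum (σ ∘ f)
    σ-sum {zero}  f = σ-0
    σ-sum {suc n} f = trans (σ-+ (f zero) (sum (f ∘ suc))) (+-congˡ (σ-sum (f ∘ suc)))

    σ-combination : ∀ {m n} (a : Vector Carrier m) (v : Family m n) k →
                    σ (combination a v k) ≈ combination (σ ∘ a) (λ i → σ ∘ v i) k
    σ-combination a v k = trans (σ-sum (λ i → a i * v i k)) (sum-cong-≋ (λ i → σ-* (a i) (v i k)))

    σ-independent : ∀ {m n} {v : Family m n} → Independent v → Independent (λ i → σ ∘ v i)
    σ-independent {v = v} independent a a·σv≋0 i = begin
      a i          ≈⟨ σ-involutive (a i) ⟨
      σ (σ (a i))  ≈⟨ σ-cong (independent (σ ∘ a) σa·v≋0 i) ⟩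
      σ 0#         ≈⟨ σ-0 ⟩
      0#           ∎
      where
      σa·v≋0 : combination (σ ∘ a) v ≋ 0⃗
      σa·v≋0 k = begin
        combination (σ ∘ a) v k
          ≈⟨ σ-involutive _ ⟨
        σ (σ (combination (σ ∘ a) v k))
          ≈⟨ σ-cong (σ-combination (σ ∘ a) v k) ⟩
        σ (combination (σ ∘ σ ∘ a) (λ i → σ ∘ v i) k)
          ≈⟨ σ-cong (combination-cong (λ i → σ ∘ v i) (σ-involutive ∘ a) k) ⟩
        σ (combination a (λ i → σ ∘ v i) k)
          ≈⟨ σ-cong (a·σv≋0 k) ⟩
        σ 0#
          ≈⟨ σ-0 ⟩
        0#
          ∎

    σ-∈span : ∀ {m n} {u : Vector Carrier n} {v : Family m n} → u ∈span v → σ ∘ u ∈span (λ i → σ ∘ v i)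
    σ-∈span {v = v} (a , u≋a·v) = σ ∘ a , λ k → trans (σ-cong (u≋a·v k)) (σ-combination a v k)

    half-rank : ∀ {m n} (R : Family m n) →
                (∀ i j → R i ∙ (σ ∘ R j) ≈ 0#) →
                (∀ a → combination a (λ i → σ ∘ R i) ≋ 0⃗ → ∃ λ w → ∀ i → a i ≈ R i ∙ w) →
                ¬ ¬ ∃ λ d → m ≤ d ℕ.+ d × d ℕ.+ d ≤ n
    half-rank R R⊥σR kernel⊆columns = do
      (d , T , T-independent , R⊆T , T⊆R) ← independent-subfamily R
      d+d≤n ← orthogonal-dimensions T-independent (σ-independent T-independent) λ b b′ →
                ≡.subst₂ (λ x y → x ∙ (σ ∘ y) ≈ 0#) (≡.sym (proj₂ (T⊆R b))) (≡.sym (proj₂ (T⊆R b′)))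
                         (R⊥σR (proj₁ (T⊆R b)) (proj₁ (T⊆R b′)))
      m≤d+d ← rank-nullity (λ i → σ ∘ R i) {P = columns (proj₁ ∘ R⊆T)}
                (λ a a·σR≋0 →
                   let (w , a≈R·w) = kernel⊆columns a a·σR≋0
                       (γ , R·w≋) = ∙-∈span-columns (proj₁ ∘ R⊆T) (proj₂ ∘ R⊆T) w
                   in γ , λ i → trans (a≈R·w i) (R·w≋ i))
                (λ i → σ-∈span (R⊆T i))
      pure (d , m≤d+d , d+d≤n)

open import Data.Vec using (Vec; _∷_; [])
open ≡ using (refl; sym; trans; cong; cong₂; subst; isEquivalence; module ≡-Reasoning)
open +-*-Solver using (Polynomial; var; con; _:+_; _:*_; _:-_; :-_; ⟦_⟧; ⟦_⟧↓; prove)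

⟨⟩-cong : ∀ {a₀ a₁ a₂ a₃ b₀ b₁ b₂ b₃} → a₀ ≡ b₀ → a₁ ≡ b₁ → a₂ ≡ b₂ → a₃ ≡ b₃ →
          ⟨ a₀ , a₁ , a₂ , a₃ ⟩ ≡ ⟨ b₀ , b₁ , b₂ , b₃ ⟩
⟨⟩-cong refl refl refl refl = refl

⊖_ : Zζ → Zζ
⊖ ⟨ a₀ , a₁ , a₂ , a₃ ⟩ = ⟨ ℤ.- a₀ , ℤ.- a₁ , ℤ.- a₂ , ℤ.- a₃ ⟩

-- Identities in ℤ[ζ] are proved coefficientwise by the ring solver for ℤ, on symbolic elements.
-- The symbolic operations mirror those of Defs term by term, so ⟦_⟧ˢ commutes with them definitionally.
record Symbolic (n : ℕ) : Set where
  constructor ⟪_,_,_,_⟫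
  field
    s₀ s₁ s₂ s₃ : Polynomial n
open Symbolic

⟦_⟧ˢ ⟦_⟧↓ˢ : ∀ {n} → Symbolic n → Vec ℤ n → Zζ
⟦ e ⟧ˢ ρ = ⟨ ⟦ s₀ e ⟧ ρ , ⟦ s₁ e ⟧ ρ , ⟦ s₂ e ⟧ ρ , ⟦ s₃ e ⟧ ρ ⟩
⟦ e ⟧↓ˢ ρ = ⟨ ⟦ s₀ e ⟧↓ ρ , ⟦ s₁ e ⟧↓ ρ , ⟦ s₂ e ⟧↓ ρ , ⟦ s₃ e ⟧↓ ρ ⟩

coefficientwise : ∀ {n} (e₁ e₂ : Symbolic n) ρ → ⟦ e₁ ⟧↓ˢ ρ ≡ ⟦ e₂ ⟧↓ˢ ρ → ⟦ e₁ ⟧ˢ ρ ≡ ⟦ e₂ ⟧ˢ ρ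
coefficientwise e₁ e₂ ρ normal-forms =
  ⟨⟩-cong (prove ρ (s₀ e₁) (s₀ e₂) (cong c0 normal-forms)) (prove ρ (s₁ e₁) (s₁ e₂) (cong c1 normal-forms))
          (prove ρ (s₂ e₁) (s₂ e₂) (cong c2 normal-forms)) (prove ρ (s₃ e₁) (s₃ e₂) (cong c3 normal-forms))

infixl 6 _⊕ˢ_
infixl 7 _⊗ˢ_
_⊕ˢ_ _⊗ˢ_ : ∀ {n} → Symbolic n → Symbolic n → Symbolic n
⟪ a0 , a1 , a2 , a3 ⟫ ⊕ˢ ⟪ b0 , b1 , b2 , b3 ⟫ = ⟪ a0 :+ b0 , a1 :+ b1 , a2 :+ b2 , a3 :+ b3 ⟫
⟪ a0 , a1 , a2 , a3 ⟫ ⊗ˢ ⟪ b0 , b1 , b2 , b3 ⟫ = ⟪ k0 :- k4 :- k5 , k1 :+ k4 :- k6 , k2 :- k4 , k3 :+ k4 ⟫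
  where
  k0 = a0 :* b0
  k1 = a0 :* b1 :+ a1 :* b0
  k2 = a0 :* b2 :+ a1 :* b1 :+ a2 :* b0
  k3 = a0 :* b3 :+ a1 :* b2 :+ a2 :* b1 :+ a3 :* b0
  k4 = a1 :* b3 :+ a2 :* b2 :+ a3 :* b1
  k5 = a2 :* b3 :+ a3 :* b2
  k6 = a3 :* b3

⊖ˢ_ conjˢ : ∀ {n} → Symbolic n → Symbolic n
⊖ˢ ⟪ a , b , c , d ⟫ = ⟪ :- a , :- b , :- c , :- d ⟫
conjˢ ⟪ a , b , c , d ⟫ = ⟪ a :+ b , :- b , b :- d , :- b :- c ⟫

0ˢ 1ˢ X Y Z : Symbolic 12
0ˢ = ⟪ con (+ 0) , con (+ 0) , con (+ 0) , con (+ 0) ⟫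
1ˢ = ⟪ con (+ 1) , con (+ 0) , con (+ 0) , con (+ 0) ⟫
X = ⟪ var (# 0) , var (# 1) , var (# 2) , var (# 3) ⟫
Y = ⟪ var (# 4) , var (# 5) , var (# 6) , var (# 7) ⟫
Z = ⟪ var (# 8) , var (# 9) , var (# 10) , var (# 11) ⟫

env : Zζ → Zζ → Zζ → Vec ℤ 12
env x y z = c0 x ∷ c1 x ∷ c2 x ∷ c3 x ∷ c0 y ∷ c1 y ∷ c2 y ∷ c3 y ∷ c0 z ∷ c1 z ∷ c2 z ∷ c3 z ∷ []

⊕-assoc : Associative _⊕_
⊕-assoc x y z = coefficientwise (X ⊕ˢ Y ⊕ˢ Z) (X ⊕ˢ (Y ⊕ˢ Z)) (env x y z) refl

⊕-comm : Commutative _⊕_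
⊕-comm x y = coefficientwise (X ⊕ˢ Y) (Y ⊕ˢ X) (env x y 0ζ) refl

⊕-identity : Identity 0ζ _⊕_
⊕-identity = (λ x → coefficientwise (0ˢ ⊕ˢ X) X (env x 0ζ 0ζ) refl)
           , (λ x → coefficientwise (X ⊕ˢ 0ˢ) X (env x 0ζ 0ζ) refl)

⊖-inverse : Inverse 0ζ ⊖_ _⊕_
⊖-inverse = (λ x → coefficientwise (⊖ˢ X ⊕ˢ X) 0ˢ (env x 0ζ 0ζ) refl)
          , (λ x → coefficientwise (X ⊕ˢ ⊖ˢ X) 0ˢ (env x 0ζ 0ζ) refl)

⊗-assoc : Associative _⊗_
⊗-assoc x y z = coefficientwise (X ⊗ˢ Y ⊗ˢ Z) (X ⊗ˢ (Y ⊗ˢ Z)) (env x y z) refl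

⊗-comm : Commutative _⊗_
⊗-comm x y = coefficientwise (X ⊗ˢ Y) (Y ⊗ˢ X) (env x y 0ζ) refl

⊗-identity : Identity 1ζ _⊗_
⊗-identity = (λ x → coefficientwise (1ˢ ⊗ˢ X) X (env x 0ζ 0ζ) refl)
           , (λ x → coefficientwise (X ⊗ˢ 1ˢ) X (env x 0ζ 0ζ) refl)

⊗-distrib-⊕ : _⊗_ DistributesOver _⊕_
⊗-distrib-⊕ = (λ x y z → coefficientwise (X ⊗ˢ (Y ⊕ˢ Z)) (X ⊗ˢ Y ⊕ˢ X ⊗ˢ Z) (env x y z) refl)
            , (λ x y z → coefficientwise ((Y ⊕ˢ Z) ⊗ˢ X) (Y ⊗ˢ X ⊕ˢ Z ⊗ˢ X) (env x y z) refl)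

Zζ-commutativeRing : CommutativeRing 0ℓ 0ℓ
Zζ-commutativeRing = record
  { _≈_ = _≡_ ; _+_ = _⊕_ ; _*_ = _⊗_ ; -_ = ⊖_ ; 0# = 0ζ ; 1# = 1ζ
  ; isCommutativeRing = record
    { isRing = record
      { +-isAbelianGroup = record
        { isGroup = record
          { isMonoid = record
            { isSemigroup = record
              { isMagma = record { isEquivalence = isEquivalence ; ∙-cong = cong₂ _⊕_ }
              ; assoc = ⊕-assoc }
            ; identity = ⊕-identity }
          ; inverse = ⊖-inverse
          ; ⁻¹-cong = cong ⊖_ }
        ; comm = ⊕-comm }
      ; *-cong = cong₂ _⊗_
      ; *-assoc = ⊗-assoc
      ; *-identity = ⊗-identity
      ; distrib = ⊗-distrib-⊕ }
    ; *-comm = ⊗-comm } }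

conj-⊕ : ∀ x y → conj (x ⊕ y) ≡ conj x ⊕ conj y
conj-⊕ x y = coefficientwise (conjˢ (X ⊕ˢ Y)) (conjˢ X ⊕ˢ conjˢ Y) (env x y 0ζ) refl

conj-⊗ : ∀ x y → conj (x ⊗ y) ≡ conj x ⊗ conj y
conj-⊗ x y = coefficientwise (conjˢ (X ⊗ˢ Y)) (conjˢ X ⊗ˢ conjˢ Y) (env x y 0ζ) refl

conj-involutive : ∀ x → conj (conj x) ≡ x
conj-involutive x = coefficientwise (conjˢ (conjˢ X)) X (env x 0ζ 0ζ) refl

ι-⊗ : ∀ m x → ι m ⊗ x ≡ ⟨ + m ℤ.* c0 x , + m ℤ.* c1 x , + m ℤ.* c2 x , + m ℤ.* c3 x ⟩
ι-⊗ m x = coefficientwise (M ⊗ˢ Y) MY (env (ι m) x 0ζ) refl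
  where
  M  = ⟪ var (# 0) , con (+ 0) , con (+ 0) , con (+ 0) ⟫
  MY = ⟪ var (# 0) :* var (# 4) , var (# 0) :* var (# 5) , var (# 0) :* var (# 6) , var (# 0) :* var (# 7) ⟫

conj-ι : ∀ m → conj (ι m) ≡ ι m
conj-ι m = ⟨⟩-cong (ℤ.+-identityʳ (+ m)) refl refl refl

ι-⊗-cancel : ∀ m .{{_ : ℕ.NonZero m}} {x y} → ι m ⊗ x ≡ ι m ⊗ y → x ≡ y
ι-⊗-cancel m {x} {y} mx≡my =
  ⟨⟩-cong (cancel (cong c0 ma≡mb)) (cancel (cong c1 ma≡mb)) (cancel (cong c2 ma≡mb)) (cancel (cong c3 ma≡mb))
  where
  ma≡mb = trans (sym (ι-⊗ m x)) (trans mx≡my (ι-⊗ m y))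
  cancel : ∀ {a b} → + m ℤ.* a ≡ + m ℤ.* b → a ≡ b
  cancel {a} {b} = ℤ.*-cancelˡ-≡ (+ m) a b

open QuotientRing Zζ-commutativeRing

conj-cong-mod : ∀ {m x y} → x ≈ y mod ι m → conj x ≈ conj y mod ι m
conj-cong-mod {m} {x} {y} (d , x≡y+md) = conj d , (begin
  conj x                         ≡⟨ cong conj x≡y+md ⟩
  conj (y ⊕ (ι m ⊗ d))           ≡⟨ conj-⊕ y (ι m ⊗ d) ⟩
  conj y ⊕ conj (ι m ⊗ d)        ≡⟨ cong (conj y ⊕_) (conj-⊗ (ι m) d) ⟩
  conj y ⊕ (conj (ι m) ⊗ conj d) ≡⟨ cong (λ z → conj y ⊕ (z ⊗ conj d)) (conj-ι m) ⟩
  conj y ⊕ (ι m ⊗ conj d)        ∎)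
  where open ≡-Reasoning

Zζ/13 : CommutativeRing 0ℓ 0ℓ
Zζ/13 = quotientRing (ι 13)

_≟ζ_ : DecidableEquality Zζ
⟨ a₀ , a₁ , a₂ , a₃ ⟩ ≟ζ ⟨ b₀ , b₁ , b₂ , b₃ ⟩ =
  map′ (λ (p₀ , p₁ , p₂ , p₃) → ⟨⟩-cong p₀ p₁ p₂ p₃)
       (λ { refl → refl , refl , refl , refl })
       (a₀ ℤ.≟ b₀ ×-dec a₁ ℤ.≟ b₁ ×-dec a₂ ℤ.≟ b₂ ×-dec a₃ ℤ.≟ b₃)

reduce : Zζ → Zζ
reduce ⟨ a₀ , a₁ , a₂ , a₃ ⟩ = ⟨ + (a₀ %ℕ 13) , + (a₁ %ℕ 13) , + (a₂ %ℕ 13) , + (a₃ %ℕ 13) ⟩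

≈reduce : ∀ x → x ≈ reduce x mod ι 13
≈reduce ⟨ a₀ , a₁ , a₂ , a₃ ⟩ = q , (begin
  ⟨ a₀ , a₁ , a₂ , a₃ ⟩
    ≡⟨ ⟨⟩-cong (split a₀) (split a₁) (split a₂) (split a₃) ⟩
  reduce ⟨ a₀ , a₁ , a₂ , a₃ ⟩ ⊕ ⟨ + 13 ℤ.* (a₀ /ℕ 13) , + 13 ℤ.* (a₁ /ℕ 13) , + 13 ℤ.* (a₂ /ℕ 13) , + 13 ℤ.* (a₃ /ℕ 13) ⟩
    ≡⟨ cong (reduce ⟨ a₀ , a₁ , a₂ , a₃ ⟩ ⊕_) (ι-⊗ 13 q) ⟨
  reduce ⟨ a₀ , a₁ , a₂ , a₃ ⟩ ⊕ (ι 13 ⊗ q)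
    ∎)
  where
  open ≡-Reasoning
  q = ⟨ a₀ /ℕ 13 , a₁ /ℕ 13 , a₂ /ℕ 13 , a₃ /ℕ 13 ⟩
  split : ∀ a → a ≡ + (a %ℕ 13) ℤ.+ + 13 ℤ.* (a /ℕ 13)
  split a = trans (a≡a%ℕn+[a/ℕn]*n a 13) (cong (λ r → + (a %ℕ 13) ℤ.+ r) (ℤ.*-comm (a /ℕ 13) (+ 13)))

-- ζ ↦ ζ³, ζ ↦ ζ⁷ and conj (ζ ↦ ζ⁹) are the other Galois automorphisms, so x ⊗ adjugate x is the
-- norm of x, an integer, which Fermat's little theorem inverts modulo 13.
σ₃ σ₇ adjugate : Zζ → Zζ
σ₃ ⟨ a , b , c , d ⟩ = ⟨ a ℤ.+ d , ℤ.- c ℤ.- d , d , b ℤ.- d ⟩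
σ₇ ⟨ a , b , c , d ⟩ = ⟨ a ℤ.- c , c ℤ.+ d , ℤ.- b ℤ.- c , c ⟩
adjugate x = σ₃ x ⊗ (σ₇ x ⊗ conj x)

opaque
  inverse-candidate : Zζ → Zζ
  inverse-candidate x = adjugate x ⊗ ι ((c0 (x ⊗ adjugate x) %ℕ 13) ℕ.^ 11)

-- 13 is inert in ℤ[ζ]; checked by computation over all 13⁴ residues.
opaque
  unfolding inverse-candidate
  residues-zero-or-invertible :
    ∀ {a} → a < 13 → ∀ {b} → b < 13 → ∀ {c} → c < 13 → ∀ {d} → d < 13 →
    let r = ⟨ + a , + b , + c , + d ⟩ in r ≡ 0ζ ⊎ reduce (r ⊗ inverse-candidate r) ≡ 1ζ
  residues-zero-or-invertible = toWitness
    {a? = ℕ.allUpTo? (λ a → ℕ.allUpTo? (λ b → ℕ.allUpTo? (λ c → ℕ.allUpTo? (λ d →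
            let r = ⟨ + a , + b , + c , + d ⟩ in r ≟ζ 0ζ ⊎-dec reduce (r ⊗ inverse-candidate r) ≟ζ 1ζ)
          13) 13) 13) 13}
    _

zero-or-invertible : ∀ x → x ≈ 0ζ mod ι 13 ⊎ ∃ λ y → x ⊗ y ≈ 1ζ mod ι 13
zero-or-invertible x = [ inj₁ ∘ reduces-to-zero , inj₂ ∘ invertible ]′
  (residues-zero-or-invertible (n%ℕd<d (c0 x) 13) (n%ℕd<d (c1 x) 13) (n%ℕd<d (c2 x) 13) (n%ℕd<d (c3 x) 13))
  where
  open CommutativeRing Zζ/13 using (*-congʳ)
  open SetoidReasoning (CommutativeRing.setoid Zζ/13)
  r = reduce x
  reduces-to-zero : r ≡ 0ζ → x ≈ 0ζ mod ι 13
  reduces-to-zero r≡0 = subst (x ≈_mod ι 13) r≡0 (≈reduce x)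
  invertible : reduce (r ⊗ inverse-candidate r) ≡ 1ζ → ∃ λ y → x ⊗ y ≈ 1ζ mod ι 13
  invertible rr⁻¹≡1 = inverse-candidate r , (begin
    x ⊗ inverse-candidate r           ≈⟨ *-congʳ {inverse-candidate r} {x} {r} (≈reduce x) ⟩
    r ⊗ inverse-candidate r           ≈⟨ ≈reduce (r ⊗ inverse-candidate r) ⟩
    reduce (r ⊗ inverse-candidate r)  ≡⟨ rr⁻¹≡1 ⟩
    1ζ                                ∎)

1≉0 : ¬ 1ζ ≈ 0ζ mod ι 13
1≉0 (⟨ d₀ , d₁ , d₂ , d₃ ⟩ , 1≡0+13d) = contradiction (∣1⇒≡1 (divides ℤ.∣ d₀ ∣ 1≡∣d₀∣*13)) λ ()
  where
  1≡13d₀ : + 1 ≡ + 13 ℤ.* d₀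
  1≡13d₀ = trans (cong c0 1≡0+13d)
                 (trans (cong (λ z → c0 (0ζ ⊕ z)) (ι-⊗ 13 ⟨ d₀ , d₁ , d₂ , d₃ ⟩)) (ℤ.+-identityˡ (+ 13 ℤ.* d₀)))
  1≡∣d₀∣*13 : 1 ≡ ℤ.∣ d₀ ∣ ℕ.* 13
  1≡∣d₀∣*13 = trans (cong ℤ.∣_∣ 1≡13d₀) (trans (ℤ.abs-* (+ 13) d₀) (ℕ.*-comm 13 ℤ.∣ d₀ ∣))

module Zζ-vectors = LinearCombinations Zζ-commutativeRing
open Zζ-vectors using (_∙_)

Σ≡∙ : ∀ {n} (u w : Vector Zζ n) → Σ[ n ] (λ k → u k ⊗ w k) ≡ u ∙ w
Σ≡∙ {zero}  u w = refl
Σ≡∙ {suc n} u w = cong ((u zero ⊗ w zero) ⊕_) (Σ≡∙ (u ∘ suc) (w ∘ suc))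

scalarI-diagonal : ∀ n m (i : Fin n) → scalarI n m i i ≡ ι m
scalarI-diagonal n m i with i Fin.≟ i
... | yes _  = refl
... | no i≢i = contradiction refl i≢i

scalarI-off-diagonal : ∀ n m {i j : Fin n} → i ≢ j → scalarI n m i j ≡ 0ζ
scalarI-off-diagonal n m {i} {j} i≢j with i Fin.≟ j
... | yes i≡j = contradiction i≡j i≢j
... | no _    = refl

scalarI-≈0 : ∀ n (i j : Fin n) → scalarI n 13 i j ≈ 0ζ mod ι 13
scalarI-≈0 n i j with i Fin.≟ j
... | yes _ = 1ζ , refl
... | no _  = ≈⇒≈mod refl

-- m a = (HH*) a = H (H̄ᵀ a) = m H w, and m cancels.
kernel-lift : ∀ {n m} .{{_ : ℕ.NonZero m}} (H : Matrix n) → (∀ i j → HH* H i j ≡ scalarI n m i j) →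
              ∀ a → (∀ x → Zζ-vectors.combination a (λ i → conj ∘ H i) x ≈ 0ζ mod ι m) →
              ∃ λ w → ∀ i → a i ≡ H i ∙ w
kernel-lift {n} {m} H HH*≡mI a a·H̄≈0 = w , λ j → ι-⊗-cancel m (begin
  ι m ⊗ a j
    ≡⟨ ⊗-comm (ι m) (a j) ⟩
  a j ⊗ ι m
    ≡⟨ cong (a j ⊗_) (scalarI-diagonal n m j) ⟨
  a j ⊗ scalarI n m j j
    ≡⟨ sum-supported (λ i → a i ⊗ scalarI n m j i) j (λ i i≢j →
         trans (cong (a i ⊗_) (scalarI-off-diagonal n m (i≢j ∘ sym))) (zeroʳ (a i))) ⟨
  sum (λ i → a i ⊗ scalarI n m j i)
    ≡⟨ sum-cong-≋ (λ i → cong (a i ⊗_) (trans (sym (HH*≡mI j i)) (Σ≡∙ (H j) (conj ∘ H i)))) ⟩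
  sum (λ i → a i ⊗ (H j ∙ (conj ∘ H i)))
    ≡⟨ ∙-combination (H j) a (λ i → conj ∘ H i) ⟨
  H j ∙ Zζ-vectors.combination a (λ i → conj ∘ H i)
    ≡⟨ sum-cong-≋ (λ x → cong (H j x ⊗_) (trans (_≈_mod_.proof (a·H̄≈0 x)) (proj₁ ⊕-identity _))) ⟩
  H j ∙ (λ x → ι m ⊗ w x)
    ≡⟨ ∙-*ʳ (H j) w (ι m) ⟩
  ι m ⊗ (H j ∙ w)
    ∎)
  where
  open ≡-Reasoning
  open Zζ-vectors using (sum-supported; ∙-combination; ∙-*ʳ)
  open CommutativeRing Zζ-commutativeRing using (zeroʳ)
  open SemiringSum (CommutativeRing.semiring Zζ-commutativeRing) using (sum; sum-cong-≋)
  w = λ x → _≈_mod_.quotient (a·H̄≈0 x)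

Zζ/13-isDiscreteField : IsDiscreteField Zζ/13
Zζ/13-isDiscreteField = record { 1≉0 = 1≉0 ; zero-or-invertible = zero-or-invertible }

open LinearAlgebra Zζ/13 Zζ/13-isDiscreteField

-- The entries of H being roots of unity is not needed: HH* = 13I over ℤ[ζ] suffices.
mainTheorem9 : ¬ Σ (Matrix 13) (IsBH10 13)
mainTheorem9 (H , _ , HH*≡13I) =
  half-rank conj conj-cong-mod conj-⊕-mod conj-⊗-mod conj-involutive-mod H rows-isotropic kernel⊆columns 13-odd
  where
  open CommutativeRing Zζ/13 using () renaming (reflexive to ≡⇒≈; trans to ≈-trans)
  conj-⊕-mod : ∀ x y → conj (x ⊕ y) ≈ conj x ⊕ conj y mod ι 13
  conj-⊕-mod x y = ≡⇒≈ (conj-⊕ x y)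
  conj-⊗-mod : ∀ x y → conj (x ⊗ y) ≈ conj x ⊗ conj y mod ι 13
  conj-⊗-mod x y = ≡⇒≈ (conj-⊗ x y)
  conj-involutive-mod : ∀ x → conj (conj x) ≈ x mod ι 13
  conj-involutive-mod x = ≡⇒≈ (conj-involutive x)
  rows-isotropic : ∀ i j → H i ∙ (conj ∘ H j) ≈ 0ζ mod ι 13
  rows-isotropic i j = ≈-trans (≡⇒≈ (trans (sym (Σ≡∙ (H i) (conj ∘ H j))) (HH*≡13I i j))) (scalarI-≈0 13 i j)
  kernel⊆columns : ∀ a → (∀ x → Zζ-vectors.combination a (λ i → conj ∘ H i) x ≈ 0ζ mod ι 13) →
                   ∃ λ w → ∀ i → a i ≈ H i ∙ w mod ι 13
  kernel⊆columns a a·H̄≋0 = map id (≡⇒≈ ∘_) (kernel-lift H HH*≡13I a a·H̄≋0)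
  13-odd : ¬ ∃ λ d → 13 ≤ d ℕ.+ d × d ℕ.+ d ≤ 13
  13-odd (d , 13≤d+d , d+d≤13) = ℕ.even≢odd d 6 (trans (cong (d ℕ.+_) (ℕ.+-identityʳ d)) (ℕ.≤-antisym d+d≤13 13≤d+d))
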